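{- Let $(\Psi;\mathcal{E},\cdot,1,0)$ be an information algebra over the join-semilattice $(D;\le)$. Then for every $x\in D$ and all ideals $I,J$ of $\Psi$: $\bar\epsilon_x(I)=\bar\epsilon_x(J)$ if and only if $I\cap\epsilon_x(\Psi)=J\cap\epsilon_x(\Psi)$.
   Context: An information algebra $(\Psi;\mathcal{E},\cdot,1,0)$ consists of a set $\Psi$ with an associative, commutative, idempotent binary operation $\cdot$ with unit $1$ and null $0$, a join-semilattice $(D;\le)$ and maps $\epsilon_x:\Psi\to\Psi$ ($x\in D$) with, for all $x,y,\phi,\psi$: (E1) $\epsilon_x(0)=0$; (E2) $\psi\cdot\epsilon_x(\psi)=\psi$; (E3) $\epsilon_x(\epsilon_x(\phi)\cdot\psi)=\epsilon_x(\phi)\cdot\epsilon_x(\psi)$; (E4) some $x$ has $\epsilon_x(\psi)=\psi$; (E5) $\epsilon_x(\psi)=\psi$ and $x\le y$ imply $\epsilon_y(\psi)=\psi$. $\epsilon_x(\Psi)=\{\psi:\epsilon_x(\psi)=\psi\}$. Information order: $\phi\le\psi$ iff $\phi\cdot\psi=\psi$. An ideal of $\Psi$ is a nonempty $I\subseteq\Psi$ such that $\phi\in I$ and $\psi\le\phi$ imply $\psi\in I$, and $\phi,\psi\in I$ imply $\phi\cdot\psi\in I$. For an ideal $I$, $\bar\epsilon_x(I)=\{\phi\in\Psi:\phi\le\epsilon_x(\psi)\text{ for some }\psi\in I\}$. -}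

module Defs where

open import Level using (Level; _⊔_; suc)
open import Data.Product using (Σ; ∃; _×_; _,_)
open import Relation.Binary.PropositionalEquality using (_≡_)
open import Relation.Binary.Lattice using (JoinSemilattice)

record InformationAlgebra (a d ℓ₁ ℓ₂ : Level) : Set (suc (a ⊔ d ⊔ ℓ₁ ⊔ ℓ₂)) where
  field
    Ψ      : Set a
    _·_    : Ψ → Ψ → Ψ
    𝟙      : Ψ
    𝟘      : Ψ
    ·-assoc : ∀ φ ψ χ → (φ · ψ) · χ ≡ φ · (ψ · χ)
    ·-comm  : ∀ φ ψ → φ · ψ ≡ ψ · φ
    ·-idem  : ∀ φ → φ · φ ≡ φ
    ·-unit  : ∀ φ → 𝟙 · φ ≡ φ
    ·-null  : ∀ φ → 𝟘 · φ ≡ 𝟘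
    D      : JoinSemilattice d ℓ₁ ℓ₂
  open JoinSemilattice D public using (_≤_) renaming (Carrier to Dom)
  field
    ε      : Dom → Ψ → Ψ
    E1 : ∀ x → ε x 𝟘 ≡ 𝟘
    E2 : ∀ x ψ → ψ · ε x ψ ≡ ψ
    E3 : ∀ x φ ψ → ε x (ε x φ · ψ) ≡ ε x φ · ε x ψ
    E4 : ∀ ψ → ∃ λ x → ε x ψ ≡ ψ
    E5 : ∀ {x y} ψ → ε x ψ ≡ ψ → x ≤ y → ε y ψ ≡ ψ

  _⊑_ : Ψ → Ψ → Set a
  φ ⊑ ψ = φ · ψ ≡ ψ

  Subset : (ℓ : Level) → Set (a ⊔ suc ℓ)
  Subset ℓ = Ψ → Set ℓ

  record IsIdeal {ℓ} (I : Subset ℓ) : Set (a ⊔ ℓ) where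
    field
      nonempty : ∃ λ φ → I φ
      downward : ∀ {φ ψ} → I φ → ψ ⊑ φ → I ψ
      closed·  : ∀ {φ ψ} → I φ → I ψ → I (φ · ψ)

  εΨ : Dom → Subset a
  εΨ x ψ = ε x ψ ≡ ψ

  ε̄ : ∀ {ℓ} → Dom → Subset ℓ → Subset (a ⊔ ℓ)
  ε̄ x I φ = ∃ λ ψ → I ψ × (φ ⊑ ε x ψ)

  _∩_ : ∀ {ℓ ℓ'} → Subset ℓ → Subset ℓ' → Subset (ℓ ⊔ ℓ')
  (A ∩ B) φ = A φ × B φ

  _≐_ : ∀ {ℓ ℓ'} → Subset ℓ → Subset ℓ' → Set (a ⊔ ℓ ⊔ ℓ')
  A ≐ B = (∀ φ → A φ → B φ) × (∀ φ → B φ → A φ)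

-- An element fixed by ε x lies in ε̄ x I exactly when it lies in I (it is
-- below ε x ψ ⊑ ψ for some ψ ∈ I, and I is downward closed), so ε̄ x I
-- determines I ∩ εΨ x. Conversely every ε x ψ with ψ ∈ I is itself in
-- I ∩ εΨ x, and ε̄ x I is the down-set it generates.
module Submission where

open import Defs
open import Level using (Level; _⊔_)
open import Data.Product using (_×_; _,_; proj₁)
open import Relation.Binary.PropositionalEquality using (_≡_; sym; trans; cong; subst; module ≡-Reasoning)

module Properties {a d ℓ₁ ℓ₂ : Level} (𝓐 : InformationAlgebra a d ℓ₁ ℓ₂) where
  open InformationAlgebra 𝓐

  _⊆_ : ∀ {ℓ ℓ'} → Subset ℓ → Subset ℓ' → Set (a ⊔ ℓ ⊔ ℓ')
  A ⊆ B = ∀ φ → A φ → B φ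

  DownwardClosed : ∀ {ℓ} → Subset ℓ → Set (a ⊔ ℓ)
  DownwardClosed I = ∀ {φ ψ} → I φ → ψ ⊑ φ → I ψ

  ⊑-refl : ∀ φ → φ ⊑ φ
  ⊑-refl = ·-idem

  ⊑-trans : ∀ {φ ψ χ} → φ ⊑ ψ → ψ ⊑ χ → φ ⊑ χ
  ⊑-trans {φ} {ψ} {χ} φ⊑ψ ψ⊑χ = trans (cong (φ ·_) (sym ψ⊑χ))
    (trans (sym (·-assoc φ ψ χ)) (trans (cong (_· χ) φ⊑ψ) ψ⊑χ))

  ε-⊑ : ∀ x ψ → ε x ψ ⊑ ψ
  ε-⊑ x ψ = trans (·-comm (ε x ψ) ψ) (E2 x ψ)

  ε-idem : ∀ x ψ → ε x (ε x ψ) ≡ ε x ψ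
  ε-idem x ψ = begin
    ε x (ε x ψ)          ≡⟨ cong (ε x) (sym (·-idem (ε x ψ))) ⟩
    ε x (ε x ψ · ε x ψ)  ≡⟨ E3 x ψ (ε x ψ) ⟩
    ε x ψ · ε x (ε x ψ)  ≡⟨ E2 x (ε x ψ) ⟩
    ε x ψ                ∎
    where open ≡-Reasoning

  εΨ⊆ε̄ : ∀ {ℓ} x (I : Subset ℓ) → (I ∩ εΨ x) ⊆ ε̄ x I
  εΨ⊆ε̄ x I φ (φ∈I , εφ≡φ) = φ , φ∈I , subst (φ ⊑_) (sym εφ≡φ) (⊑-refl φ)

  ε̄⊆ : ∀ {ℓ} x {I : Subset ℓ} → DownwardClosed I → ε̄ x I ⊆ I
  ε̄⊆ x I↓ φ (ψ , ψ∈I , φ⊑εψ) = I↓ ψ∈I (⊑-trans φ⊑εψ (ε-⊑ x ψ))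

  ε̄-⊆⇒∩εΨ-⊆ : ∀ {ℓ ℓ'} x {I : Subset ℓ} {J : Subset ℓ'} → DownwardClosed J →
    ε̄ x I ⊆ ε̄ x J → (I ∩ εΨ x) ⊆ (J ∩ εΨ x)
  ε̄-⊆⇒∩εΨ-⊆ x {I} J↓ I⊆J φ φ∈I∩εΨ@(_ , εφ≡φ) =
    ε̄⊆ x J↓ φ (I⊆J φ (εΨ⊆ε̄ x I φ φ∈I∩εΨ)) , εφ≡φ

  ∩εΨ-⊆⇒ε̄-⊆ : ∀ {ℓ ℓ'} x {I : Subset ℓ} {J : Subset ℓ'} → DownwardClosed I →
    (I ∩ εΨ x) ⊆ (J ∩ εΨ x) → ε̄ x I ⊆ ε̄ x J
  ∩εΨ-⊆⇒ε̄-⊆ x I↓ I⊆J φ (ψ , ψ∈I , φ⊑εψ) =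
    ε x ψ , proj₁ (I⊆J (ε x ψ) (I↓ ψ∈I (ε-⊑ x ψ) , ε-idem x ψ)) ,
    subst (φ ⊑_) (sym (ε-idem x ψ)) φ⊑εψ

mainTheorem19 : ∀ {a d ℓ₁ ℓ₂ ℓ : Level} (𝓐 : InformationAlgebra a d ℓ₁ ℓ₂) →
    let open InformationAlgebra 𝓐 in
    ∀ (x : Dom) (I J : Subset ℓ) → IsIdeal I → IsIdeal J →
    ((ε̄ x I ≐ ε̄ x J) → ((I ∩ εΨ x) ≐ (J ∩ εΨ x))) ×
    (((I ∩ εΨ x) ≐ (J ∩ εΨ x)) → (ε̄ x I ≐ ε̄ x J))
mainTheorem19 𝓐 x I J I-ideal J-ideal =
  (λ (I⊆J , J⊆I) → ε̄-⊆⇒∩εΨ-⊆ x J↓ I⊆J , ε̄-⊆⇒∩εΨ-⊆ x I↓ J⊆I) ,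
  (λ (I⊆J , J⊆I) → ∩εΨ-⊆⇒ε̄-⊆ x I↓ I⊆J , ∩εΨ-⊆⇒ε̄-⊆ x J↓ J⊆I)
  where
    open InformationAlgebra 𝓐
    open Properties 𝓐
    I↓ : DownwardClosed I
    I↓ = IsIdeal.downward I-ideal
    J↓ : DownwardClosed J
    J↓ = IsIdeal.downward J-ideal
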